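{- Let $N$ be a positive integer, let $c \in \mathbb{Q}$, and let $\phi_c(z) = z^2 + c$. Let $K$ be a finite Galois extension of $\mathbb{Q}$ of degree $d = [K:\mathbb{Q}]$, and let $g = \gcd(N, d)$. Let $(z_0, \dots, z_{N-1})$ be an exact $N$-cycle of $\phi_c$ with all $z_j \in K$ and $\phi_c(z_j) = z_{j+1}$ for all $j \in \mathbb{Z}/N\mathbb{Z}$. Then exactly one of the following holds: (i) there exist $m \in \mathbb{Z}/g\mathbb{Z}$ and a nontrivial $\tau \in \mathrm{Gal}(K/\mathbb{Q})$ such that $z_{m \cdot \frac{N}{g}} = \tau(z_0)$; (ii) for every nontrivial $\tau \in \mathrm{Gal}(K/\mathbb{Q})$, $\{z_0, \dots, z_{N-1}\} \cap \{\tau(z_0), \dots, \tau(z_{N-1})\} = \emptyset$.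
   Context: For a map $\phi$, $\phi^n$ denotes its $n$-th iterate. A point $z$ is a periodic point of period $N$ of $\phi$ if $\phi^N(z) = z$; its orbit $(z, \phi(z), \dots, \phi^{N-1}(z))$ is an $N$-cycle. It is an exact $N$-cycle (and $z$ has exact period $N$) if $\phi(z), \dots, \phi^{N-1}(z)$ are all distinct from $z$. Indices of the cycle are taken modulo $N$. -}

module Defs where

open import Level using (Level; _⊔_) renaming (suc to lsuc)
open import Algebra.Bundles using (CommutativeRing)
open import Data.Nat using (ℕ; zero; suc; NonZero; _/_; _<_; ≢-nonZero; ≢-nonZero⁻¹) renaming (_*_ to _*ℕ_)
open import Data.Nat.GCD using (gcd; gcd[m,n]≢0)
open import Data.Fin using (Fin)
open import Data.Rational as ℚ using (ℚ)
open import Data.Sum using (_⊎_; inj₁; inj₂)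
open import Data.Product using (Σ; ∃; _×_; _,_; proj₁)
open import Relation.Nullary using (¬_)
open import Relation.Binary.PropositionalEquality using (_≡_)

record Field (c ℓ : Level) : Set (lsuc (c ⊔ ℓ)) where
  field
    commutativeRing : CommutativeRing c ℓ
  open CommutativeRing commutativeRing public
  field
    0≉1     : ¬ (0# ≈ 1#)
    inverse : ∀ x → ¬ (x ≈ 0#) → ∃ λ y → (x * y) ≈ 1#

module _ {c ℓ} (K : Field c ℓ) where
  open Field K

  ∑ : (n : ℕ) → (Fin n → Carrier) → Carrier
  ∑ zero    f = 0#
  ∑ (suc n) f = f Fin.zero + ∑ n (λ i → f (Fin.suc i))

record ExtensionOfℚ (c ℓ : Level) : Set (lsuc (c ⊔ ℓ)) where
  field
    field′ : Field c ℓ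
  open Field field′ public
  field
    ι    : ℚ → Carrier
    ι-+  : ∀ p q → ι (p ℚ.+ q) ≈ (ι p + ι q)
    ι-*  : ∀ p q → ι (p ℚ.* q) ≈ (ι p * ι q)
    ι-1  : ι ℚ.1ℚ ≈ 1#

module _ {c ℓ} (K : ExtensionOfℚ c ℓ) where
  open ExtensionOfℚ K

  IsBasis : (d : ℕ) → (Fin d → Carrier) → Set (c ⊔ ℓ)
  IsBasis d b =
    (∀ x → ∃ λ (a : Fin d → ℚ) → x ≈ ∑ field′ d (λ i → ι (a i) * b i)) ×
    (∀ (a a′ : Fin d → ℚ) →
       ∑ field′ d (λ i → ι (a i) * b i) ≈ ∑ field′ d (λ i → ι (a′ i) * b i) →
       ∀ i → a i ≡ a′ i)

  HasDegree : ℕ → Set (c ⊔ ℓ)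
  HasDegree d = ∃ λ (b : Fin d → Carrier) → IsBasis d b

  record IsℚAutomorphism (σ : Carrier → Carrier) : Set (c ⊔ ℓ) where
    field
      cong       : ∀ {x y} → x ≈ y → σ x ≈ σ y
      hom-+      : ∀ x y → σ (x + y) ≈ (σ x + σ y)
      hom-*      : ∀ x y → σ (x * y) ≈ (σ x * σ y)
      hom-1      : σ 1# ≈ 1#
      fixes-ℚ    : ∀ q → σ (ι q) ≈ ι q
      injective  : ∀ {x y} → σ x ≈ σ y → x ≈ y
      surjective : ∀ y → ∃ λ x → σ x ≈ y

  Gal : Set (c ⊔ ℓ)
  Gal = Σ (Carrier → Carrier) IsℚAutomorphism

  _≈Gal_ : Gal → Gal → Set (c ⊔ ℓ)
  (σ , _) ≈Gal (τ , _) = ∀ x → σ x ≈ τ x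

  Nontrivial : Gal → Set (c ⊔ ℓ)
  Nontrivial (τ , _) = ¬ (∀ x → τ x ≈ x)

  GalHasSize : ℕ → Set (c ⊔ ℓ)
  GalHasSize n = ∃ λ (σs : Fin n → Gal) →
    (∀ i j → σs i ≈Gal σs j → i ≡ j) × (∀ τ → ∃ λ i → τ ≈Gal σs i)

  -- K/ℚ is a finite Galois extension of degree d:
  -- [K:ℚ] = d and |Aut(K/ℚ)| = [K:ℚ].
  IsGaloisOfDegree : ℕ → Set (c ⊔ ℓ)
  IsGaloisOfDegree d = HasDegree d × GalHasSize d

  φ : ℚ → Carrier → Carrier
  φ c z = z * z + ι c

iterate : ∀ {a} {A : Set a} → (A → A) → ℕ → A → A
iterate f zero    x = x
iterate f (suc n) x = f (iterate f n x)

N/g : (N d : ℕ) → .{{NonZero N}} → ℕ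
N/g N d = _/_ N (gcd N d) {{≢-nonZero (gcd[m,n]≢0 N d (inj₁ (≢-nonZero⁻¹ N)))}}

module _ {c ℓ} (K : ExtensionOfℚ c ℓ) where
  open ExtensionOfℚ K using (Carrier; _≈_)

  IsExactPeriod : ℚ → ℕ → Carrier → Set ℓ
  IsExactPeriod q N z = (iterate (φ K q) N z ≈ z) ×
    (∀ k → 0 < k → k < N → ¬ (iterate (φ K q) k z ≈ z))

  orbit : ℚ → Carrier → ℕ → Carrier
  orbit q z₀ j = iterate (φ K q) j z₀

  -- (i): ∃ m ∈ ℤ/gℤ (represented by 0 ≤ m < g) and nontrivial τ with z_{m·N/g} = τ(z₀)
  CaseI : ℚ → (N d : ℕ) → .{{NonZero N}} → Carrier → Set (c ⊔ ℓ)
  CaseI q N d z₀ = ∃ λ m → m < gcd N d × ∃ λ (τ : Gal K) → Nontrivial K τ ×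
    (orbit q z₀ (m *ℕ N/g N d) ≈ proj₁ τ (orbit q z₀ 0))

  CaseII : ℚ → ℕ → Carrier → Set (c ⊔ ℓ)
  CaseII q N z₀ = ∀ (τ : Gal K) → Nontrivial K τ → ∀ i j → i < N → j < N →
    ¬ (orbit q z₀ i ≈ proj₁ τ (orbit q z₀ j))

-- Every τ ∈ Gal(K/ℚ) commutes with φ_c.  So if a nontrivial τ maps a point of the cycle into
-- the cycle, then τ(z₀) = z_s for some s and τⁿ(z₀) = z_{ns}; since τ^d = id (Lagrange),
-- z_{ds} = z₀, so N ∣ ds, i.e. N/g ∣ s, which is (i).  Otherwise (ii) holds; the dichotomy is
-- decided by a finite search, as the cycle and Gal(K/ℚ) are finite and equality in K is
-- decidable through a ℚ-basis.  Finally (i) exhibits a point z_{m·N/g} of the cycle in its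
-- τ-image, contradicting (ii).
module Submission where

open import Defs
open import Level using (Level)
open import Data.Nat
  using (ℕ; NonZero; zero; suc; pred; _+_; _*_; _∸_; _<_; _<?_; _/_; _%_; z<s;
         >-nonZero; ≢-nonZero; ≢-nonZero⁻¹; >-nonZero⁻¹)
open import Data.Nat.Properties
  using (+-comm; *-comm; ≤-reflexive; <-trans; ≤-<-trans; <⇒≤; n<1+n; m<n+m; m∸n≤m; m∸n+n≡m; m+[n∸m]≡n;
         m<n⇒0<n∸m; suc-pred; *-monoˡ-<; *-cancelʳ-<; anyUpTo?)
open import Data.Nat.Divisibility
  using (_∣_; divides; _∣0; ∣⇒≤; ∣-refl; ∣m∣n⇒∣m+n; m%n≡0⇒n∣m; *-cancelˡ-∣; m∣m*n)
open import Data.Nat.DivMod using (m≡m%n+[m/n]*n; m%n<n; m*[n/m]≡n; m≥n⇒m/n>0)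
open import Data.Nat.GCD using (gcd; gcd-greatest; gcd-comm; gcd[m,n]∣m; gcd[m,n]≢0; c*gcd[m,n]≡gcd[cm,cn])
open import Data.Nat.Induction using (<-wellFounded)
open import Induction.WellFounded using (Acc; acc)
open import Data.Rational using (ℚ)
import Data.Rational.Properties as ℚ
open import Data.Fin using (Fin; toℕ)
open import Data.Fin.Properties using (any?; all?; pigeonhole) renaming (_≟_ to _≟ᶠ_)
open import Data.List using (List; []; _∷_; length; _++_; applyUpTo; filter; allFin)
open import Data.List.Properties using (length-++; length-applyUpTo; length-tabulate)
open import Data.List.Relation.Unary.Any using (here)
open import Data.List.Relation.Unary.Unique.Propositional using (Unique)
open import Data.List.Relation.Unary.Unique.Propositional.Properties using (applyUpTo⁺₁; filter⁺; ++⁺; allFin⁺)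
open import Data.List.Relation.Binary.Subset.Propositional using (_⊆_)
open import Data.List.Relation.Binary.BagAndSetEquality using (∼bag⇒↭)
open import Data.List.Relation.Binary.Permutation.Propositional.Properties using (↭-length)
open import Data.List.Membership.Propositional using (_∈_; _∉_)
open import Data.List.Membership.Propositional.Properties
  using (∈-applyUpTo⁺; ∈-applyUpTo⁻; ∈-filter⁺; ∈-filter⁻; ∈-++⁺ˡ; ∈-++⁺ʳ; ∈-++⁻; ∈-allFin)
open import Data.List.Membership.Propositional.Properties.WithK using (unique∧set⇒bag)
open import Data.Sum using (_⊎_; inj₁; inj₂; [_,_]′)
open import Data.Product using (∃; _×_; _,_; proj₁; proj₂)
open import Data.Empty using (⊥-elim)
open import Function using (_∘_)
open import Function.Bundles using (_⇔_; mk⇔)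
open import Function.Definitions using (Injective)
open import Relation.Nullary using (¬_; Dec; yes; no; ¬?; _×-dec_)
open import Relation.Unary using (Pred) renaming (Decidable to Decidable₁)
open import Relation.Binary using (Setoid; Decidable; DecidableEquality)
open import Relation.Binary.PropositionalEquality as ≡ using (_≡_; cong; cong₂; subst; subst₂)
import Relation.Binary.Reasoning.Setoid as SetoidReasoning

iterate-+ : ∀ {a} {A : Set a} (f : A → A) m n x → iterate f (m + n) x ≡ iterate f m (iterate f n x)
iterate-+ f zero    n x = ≡.refl
iterate-+ f (suc m) n x = cong f (iterate-+ f m n x)

iterate-injective : ∀ {a} {A : Set a} {f : A → A} → Injective _≡_ _≡_ f →
                    ∀ n → Injective _≡_ _≡_ (iterate f n)
iterate-injective f-injective zero    eq = eq
iterate-injective f-injective (suc n) eq = iterate-injective f-injective n (f-injective eq)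

HasExactPeriod : ∀ {a ℓ} (S : Setoid a ℓ) → (Setoid.Carrier S → Setoid.Carrier S) → ℕ → Setoid.Carrier S → Set ℓ
HasExactPeriod S f n x = iterate f n x ≈ x × (∀ k → 0 < k → k < n → ¬ (iterate f k x ≈ x))
  where open Setoid S

module SetoidIteration {a ℓ} (S : Setoid a ℓ) {f : Setoid.Carrier S → Setoid.Carrier S}
                       (f-cong : ∀ {x y} → Setoid._≈_ S x y → Setoid._≈_ S (f x) (f y)) where
  open Setoid S using (Carrier; _≈_) renaming (refl to ≈-refl; sym to ≈-sym; trans to ≈-trans)
  open SetoidReasoning S

  iterate-cong : ∀ n {x y} → x ≈ y → iterate f n x ≈ iterate f n y
  iterate-cong zero    x≈y = x≈y
  iterate-cong (suc n) x≈y = f-cong (iterate-cong n x≈y)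

  iterate-commute : ∀ {h : Carrier → Carrier} → (∀ {x y} → x ≈ y → h x ≈ h y) →
                    (∀ x → h (f x) ≈ f (h x)) → ∀ n x → h (iterate f n x) ≈ iterate f n (h x)
  iterate-commute h-cong h∘f≈f∘h zero    x = ≈-refl
  iterate-commute h-cong h∘f≈f∘h (suc n) x = ≈-trans (h∘f≈f∘h _) (f-cong (iterate-commute h-cong h∘f≈f∘h n x))

  iterate-*-period : ∀ {n x} → iterate f n x ≈ x → ∀ q → iterate f (q * n) x ≈ x
  iterate-*-period         fix zero    = ≈-refl
  iterate-*-period {n} {x} fix (suc q) = begin
    iterate f (n + q * n) x           ≡⟨ iterate-+ f n (q * n) x ⟩
    iterate f n (iterate f (q * n) x) ≈⟨ iterate-cong n (iterate-*-period fix q) ⟩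
    iterate f n x                     ≈⟨ fix ⟩
    x                                 ∎

  iterate-% : ∀ {n x} .{{_ : NonZero n}} → iterate f n x ≈ x → ∀ m → iterate f m x ≈ iterate f (m % n) x
  iterate-% {n} {x} fix m = begin
    iterate f m x                                   ≡⟨ cong (λ k → iterate f k x) (m≡m%n+[m/n]*n m n) ⟩
    iterate f (m % n + m / n * n) x                 ≡⟨ iterate-+ f (m % n) (m / n * n) x ⟩
    iterate f (m % n) (iterate f (m / n * n) x)     ≈⟨ iterate-cong (m % n) (iterate-*-period fix (m / n)) ⟩
    iterate f (m % n) x                             ∎

  exactPeriod∣ : ∀ {n x} .{{_ : NonZero n}} → HasExactPeriod S f n x → ∀ {m} → iterate f m x ≈ x → n ∣ m
  exactPeriod∣ {n} {x} (fix , minimal) {m} m-fix with m % n in m%n≡r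
  ... | zero  = m%n≡0⇒n∣m m n m%n≡r
  ... | suc r = ⊥-elim (minimal (suc r) z<s (subst (_< n) m%n≡r (m%n<n m n))
                  (subst (λ k → iterate f k x ≈ x) m%n≡r (≈-trans (≈-sym (iterate-% fix m)) m-fix)))

-- The orbits of a permutation all of whose points have exact period o partition any
-- closed finite set into blocks of size o.
module OrbitCounting {a} {A : Set a} (_≟_ : DecidableEquality A) {f : A → A} (f-injective : Injective _≡_ _≡_ f)
                     {o : ℕ} .{{_ : NonZero o}} (exact : ∀ x → HasExactPeriod (≡.setoid A) f o x) where
  open import Data.List.Membership.DecPropositional _≟_ using (_∈?_)
  open ≡.≡-Reasoning

  cycle : A → List A
  cycle x = applyUpTo (λ k → iterate f k x) o

  cycle-unique : ∀ x → Unique (cycle x)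
  cycle-unique x = applyUpTo⁺₁ _ o λ {i} {j} i<j j<o fⁱx≡fʲx →
    proj₂ (exact (iterate f i x)) (j ∸ i) (m<n⇒0<n∸m i<j) (≤-<-trans (m∸n≤m j i) j<o) (begin
      iterate f (j ∸ i) (iterate f i x) ≡⟨ iterate-+ f (j ∸ i) i x ⟨
      iterate f (j ∸ i + i) x           ≡⟨ cong (λ k → iterate f k x) (m∸n+n≡m (<⇒≤ i<j)) ⟩
      iterate f j x                     ≡⟨ fⁱx≡fʲx ⟨
      iterate f i x                     ∎)

  ∈-cycle-pred : ∀ {x y} → f y ∈ cycle x → y ∈ cycle x
  ∈-cycle-pred {x} {y} fy∈ with ∈-applyUpTo⁻ _ fy∈
  ... | suc k , k<o , fy≡ = subst (_∈ cycle x) (≡.sym (f-injective fy≡)) (∈-applyUpTo⁺ _ (<-trans (n<1+n k) k<o))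
  ... | zero  , _   , fy≡ = subst (_∈ cycle x) (≡.sym (f-injective (begin
      f y                        ≡⟨ fy≡ ⟩
      x                          ≡⟨ proj₁ (exact x) ⟨
      iterate f o x              ≡⟨ cong (λ k → iterate f k x) (suc-pred o) ⟨
      f (iterate f (pred o) x)   ∎)))
    (∈-applyUpTo⁺ _ (≤-reflexive (suc-pred o)))

  Closed : List A → Set a
  Closed L = ∀ {x} → x ∈ L → f x ∈ L

  cycle⊆ : ∀ {L x} → Closed L → x ∈ L → cycle x ⊆ L
  cycle⊆ {L} {x} closed x∈L y∈ with k , _ , ≡.refl ← ∈-applyUpTo⁻ _ y∈ = iterate-∈ k
    where
    iterate-∈ : ∀ k → iterate f k x ∈ L
    iterate-∈ zero    = x∈L
    iterate-∈ (suc k) = closed (iterate-∈ k)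

  ∉cycle? : ∀ x → Decidable₁ (_∉ cycle x)
  ∉cycle? x y = ¬? (y ∈? cycle x)

  _∖cycle_ : List A → A → List A
  L ∖cycle x = filter (∉cycle? x) L

  ∖cycle-closed : ∀ {L} x → Closed L → Closed (L ∖cycle x)
  ∖cycle-closed x closed y∈ with y∈L , y∉ ← ∈-filter⁻ (∉cycle? x) y∈ =
    ∈-filter⁺ (∉cycle? x) (closed y∈L) (y∉ ∘ ∈-cycle-pred)

  length-∖cycle : ∀ {L x} → Unique L → Closed L → x ∈ L → length L ≡ o + length (L ∖cycle x)
  length-∖cycle {L} {x} unique closed x∈L = begin
    length L                                  ≡⟨ ↭-length (∼bag⇒↭ (unique∧set⇒bag unique split-unique L⇔split)) ⟩
    length (cycle x ++ L ∖cycle x)            ≡⟨ length-++ (cycle x) ⟩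
    length (cycle x) + length (L ∖cycle x)    ≡⟨ cong (_+ length (L ∖cycle x)) (length-applyUpTo _ o) ⟩
    o + length (L ∖cycle x)                   ∎
    where
    split-unique : Unique (cycle x ++ L ∖cycle x)
    split-unique = ++⁺ (cycle-unique x) (filter⁺ (∉cycle? x) unique)
                       λ (y∈ , y∈′) → proj₂ (∈-filter⁻ (∉cycle? x) {xs = L} y∈′) y∈

    split : ∀ {y} → y ∈ L → y ∈ cycle x ++ L ∖cycle x
    split {y} y∈L with y ∈? cycle x
    ... | yes y∈ = ∈-++⁺ˡ y∈
    ... | no  y∉ = ∈-++⁺ʳ (cycle x) (∈-filter⁺ (∉cycle? x) y∈L y∉)

    join : ∀ {y} → y ∈ cycle x ++ L ∖cycle x → y ∈ L
    join y∈ = [ cycle⊆ closed x∈L , proj₁ ∘ ∈-filter⁻ (∉cycle? x) ]′ (∈-++⁻ (cycle x) y∈)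

    L⇔split : ∀ {y} → (y ∈ L) ⇔ (y ∈ cycle x ++ L ∖cycle x)
    L⇔split = mk⇔ split join

  exactPeriod∣length : ∀ L → Unique L → Closed L → o ∣ length L
  exactPeriod∣length L = go L (<-wellFounded (length L))
    where
    go : ∀ L → Acc _<_ (length L) → Unique L → Closed L → o ∣ length L
    go []          _        _      _      = o ∣0
    go L@(x ∷ _)   (acc rs) unique closed =
      subst (o ∣_) (≡.sym L≡o+L′) (∣m∣n⇒∣m+n ∣-refl
        (go (L ∖cycle x) (rs shorter) (filter⁺ (∉cycle? x) unique) (∖cycle-closed x closed)))
      where
      L≡o+L′ : length L ≡ o + length (L ∖cycle x)
      L≡o+L′ = length-∖cycle unique closed (here ≡.refl)

      shorter : length (L ∖cycle x) < length L
      shorter = subst (length (L ∖cycle x) <_) (≡.sym L≡o+L′) (m<n+m _ (>-nonZero⁻¹ o))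

least-positive : ∀ {p} {P : Pred ℕ p} → Decidable₁ P → ∀ {n} → 0 < n → P n →
                 ∃ λ m → 0 < m × P m × (∀ k → 0 < k → k < m → ¬ P k)
least-positive {P = P} P? {n} = go n (<-wellFounded n)
  where
  go : ∀ n → Acc _<_ n → 0 < n → P n → ∃ λ m → 0 < m × P m × (∀ k → 0 < k → k < m → ¬ P k)
  go n (acc rs) 0<n Pn with anyUpTo? (λ k → (0 <? k) ×-dec P? k) n
  ... | yes (k , k<n , 0<k , Pk) = go k (rs k<n) 0<k Pk
  ... | no  none                 = n , 0<n , Pn , λ k 0<k k<n Pk → none (k , k<n , 0<k , Pk)

module _ {d : ℕ} {f : Fin d → Fin d} (f-injective : Injective _≡_ _≡_ f) where
  open ≡.≡-Reasoning

  iterate-returns : ∀ x → ∃ λ n → 0 < n × iterate f n x ≡ x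
  iterate-returns x with i , j , i<j , fⁱx≡fʲx ← pigeonhole (n<1+n d) (λ i → iterate f (toℕ i) x) =
    toℕ j ∸ toℕ i , m<n⇒0<n∸m i<j , iterate-injective f-injective (toℕ i) (begin
      iterate f (toℕ i) (iterate f (toℕ j ∸ toℕ i) x) ≡⟨ iterate-+ f (toℕ i) _ x ⟨
      iterate f (toℕ i + (toℕ j ∸ toℕ i)) x           ≡⟨ cong (λ k → iterate f k x) (m+[n∸m]≡n (<⇒≤ i<j)) ⟩
      iterate f (toℕ j) x                             ≡⟨ fⁱx≡fʲx ⟨
      iterate f (toℕ i) x                             ∎)

  -- The least period o of x is then the exact period of every point, so o ∣ d by counting cycles.
  iterate-card≡id : (∀ n x y → iterate f n x ≡ x → iterate f n y ≡ y) → ∀ x → iterate f d x ≡ x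
  iterate-card≡id same-periods x =
    let n , 0<n , fⁿx≡x           = iterate-returns x
        o , 0<o , fᵒx≡x , minimal = least-positive {P = λ k → iterate f k x ≡ x} (λ k → iterate f k x ≟ᶠ x) 0<n fⁿx≡x
        exact : ∀ y → HasExactPeriod (≡.setoid (Fin d)) f o y
        exact y = same-periods o x y fᵒx≡x , λ k 0<k k<o fᵏy≡y → minimal k 0<k k<o (same-periods k y x fᵏy≡y)
        o∣d : o ∣ d
        o∣d = subst (o ∣_) (length-tabulate {n = d} (λ i → i))
          (OrbitCounting.exactPeriod∣length _≟ᶠ_ f-injective {{>-nonZero 0<o}} exact
            (allFin d) (allFin⁺ d) (λ _ → ∈-allFin _))
        divides q d≡q*o = o∣d
    in subst (λ k → iterate f k x ≡ x) (≡.sym d≡q*o) (iterate-*-period {o} fᵒx≡x q)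
    where open SetoidIteration (≡.setoid (Fin d)) (cong f) using (iterate-*-period)

module Galois {a ℓ} (K : ExtensionOfℚ a ℓ) where
  open ExtensionOfℚ K renaming (_+_ to _+ᴷ_; _*_ to _*ᴷ_)
  open SetoidReasoning setoid

  Gal-id : Gal K
  Gal-id = (λ x → x) , record
    { cong = λ x≈y → x≈y ; hom-+ = λ _ _ → refl ; hom-* = λ _ _ → refl ; hom-1 = refl
    ; fixes-ℚ = λ _ → refl ; injective = λ x≈y → x≈y ; surjective = λ y → y , refl }

  Gal-∘ : Gal K → Gal K → Gal K
  Gal-∘ (σ , σ-aut) (τ , τ-aut) = (λ x → σ (τ x)) , record
    { cong       = λ x≈y → S.cong (T.cong x≈y)
    ; hom-+      = λ x y → trans (S.cong (T.hom-+ x y)) (S.hom-+ _ _)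
    ; hom-*      = λ x y → trans (S.cong (T.hom-* x y)) (S.hom-* _ _)
    ; hom-1      = trans (S.cong T.hom-1) S.hom-1
    ; fixes-ℚ    = λ q → trans (S.cong (T.fixes-ℚ q)) (S.fixes-ℚ q)
    ; injective  = λ στx≈στy → T.injective (S.injective στx≈στy)
    ; surjective = λ y → let u , σu≈y = S.surjective y ; v , τv≈u = T.surjective u in v , trans (S.cong τv≈u) σu≈y
    }
    where
    module S = IsℚAutomorphism σ-aut
    module T = IsℚAutomorphism τ-aut

  ∑-cong : ∀ n {u v : Fin n → Carrier} → (∀ i → u i ≈ v i) → ∑ field′ n u ≈ ∑ field′ n v
  ∑-cong zero    u≈v = refl
  ∑-cong (suc n) u≈v = +-cong (u≈v Fin.zero) (∑-cong n (λ i → u≈v (Fin.suc i)))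

  -- Compare rational coordinates in the basis.
  ≈-dec : ∀ {d} → HasDegree K d → Decidable _≈_
  ≈-dec {d} (b , span , unique) x y with all? (λ i → proj₁ (span x) i ℚ.≟ proj₁ (span y) i)
  ... | yes same = yes (begin
    x                                                 ≈⟨ proj₂ (span x) ⟩
    ∑ field′ d (λ i → ι (proj₁ (span x) i) *ᴷ b i)     ≈⟨ ∑-cong d (λ i → *-cong (reflexive (cong ι (same i))) refl) ⟩
    ∑ field′ d (λ i → ι (proj₁ (span y) i) *ᴷ b i)     ≈⟨ proj₂ (span y) ⟨
    y                                                 ∎)
  ... | no differ = no λ x≈y → differ (unique _ _ (trans (sym (proj₂ (span x))) (trans x≈y (proj₂ (span y)))))

  module _ {d} (size : GalHasSize K d) where
    private
      σs : Fin d → Gal K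
      σs = proj₁ size

      distinct : ∀ i j → _≈Gal_ K (σs i) (σs j) → i ≡ j
      distinct = proj₁ (proj₂ size)

      cover : ∀ τ → ∃ λ i → _≈Gal_ K τ (σs i)
      cover = proj₂ (proj₂ size)

      σ : Fin d → Carrier → Carrier
      σ i = proj₁ (σs i)

      e : Fin d
      e = proj₁ (cover Gal-id)

      ≢e⇒nontrivial : ∀ i → ¬ i ≡ e → Nontrivial K (σs i)
      ≢e⇒nontrivial i i≢e σᵢ≈id = i≢e (distinct i e λ x → trans (σᵢ≈id x) (proj₂ (cover Gal-id) x))

      nontrivial⇒≢e : ∀ τ → Nontrivial K τ → ¬ proj₁ (cover τ) ≡ e
      nontrivial⇒≢e τ nontrivial k≡e = nontrivial λ x → begin
        proj₁ τ x                ≈⟨ proj₂ (cover τ) x ⟩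
        σ (proj₁ (cover τ)) x    ≡⟨ cong (λ k → σ k x) k≡e ⟩
        σ e x                    ≈⟨ proj₂ (cover Gal-id) x ⟨
        x                        ∎

    ∃-nontrivial? : ∀ {p} (P : Gal K → Set p) → (∀ σ τ → _≈Gal_ K σ τ → P σ → P τ) → (∀ τ → Dec (P τ)) →
                    Dec (∃ λ τ → Nontrivial K τ × P τ)
    ∃-nontrivial? P resp P? with any? (λ i → ¬? (i ≟ᶠ e) ×-dec P? (σs i))
    ... | yes (i , i≢e , Pσᵢ) = yes (σs i , ≢e⇒nontrivial i i≢e , Pσᵢ)
    ... | no  none            = no λ (τ , nontrivial , Pτ) →
      none (proj₁ (cover τ) , nontrivial⇒≢e τ nontrivial , resp τ (σs (proj₁ (cover τ))) (proj₂ (cover τ)) Pτ)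

    -- Left translation by τ permutes the enumeration σs; its periods are the exponents n with τⁿ = id.
    module _ (τ : Gal K) where
      private
        module T = IsℚAutomorphism (proj₂ τ)
        open SetoidIteration setoid T.cong using (iterate-cong)

        translate : Fin d → Fin d
        translate i = proj₁ (cover (Gal-∘ τ (σs i)))

        translate-spec : ∀ i x → proj₁ τ (σ i x) ≈ σ (translate i) x
        translate-spec i = proj₂ (cover (Gal-∘ τ (σs i)))

        translate-injective : Injective _≡_ _≡_ translate
        translate-injective {i} {j} πi≡πj = distinct i j λ x → T.injective (begin
          proj₁ τ (σ i x)      ≈⟨ translate-spec i x ⟩
          σ (translate i) x    ≡⟨ cong (λ k → σ k x) πi≡πj ⟩
          σ (translate j) x    ≈⟨ translate-spec j x ⟨
          proj₁ τ (σ j x)      ∎)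

        iterate-translate : ∀ n i x → iterate (proj₁ τ) n (σ i x) ≈ σ (iterate translate n i) x
        iterate-translate zero    i x = refl
        iterate-translate (suc n) i x = trans (T.cong (iterate-translate n i x)) (translate-spec _ x)

        translate-fix⇒τ-period : ∀ n i → iterate translate n i ≡ i → ∀ x → iterate (proj₁ τ) n x ≈ x
        translate-fix⇒τ-period n i πⁿi≡i x = let y , σᵢy≈x = IsℚAutomorphism.surjective (proj₂ (σs i)) x in begin
          iterate (proj₁ τ) n x          ≈⟨ iterate-cong n σᵢy≈x ⟨
          iterate (proj₁ τ) n (σ i y)    ≈⟨ iterate-translate n i y ⟩
          σ (iterate translate n i) y    ≡⟨ cong (λ k → σ k y) πⁿi≡i ⟩
          σ i y                          ≈⟨ σᵢy≈x ⟩
          x                              ∎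

        τ-period⇒translate-fix : ∀ n i → (∀ x → iterate (proj₁ τ) n x ≈ x) → iterate translate n i ≡ i
        τ-period⇒translate-fix n i τⁿ≈id = distinct _ i λ x → trans (sym (iterate-translate n i x)) (τⁿ≈id (σ i x))

      Gal-iterate-size≈id : ∀ x → iterate (proj₁ τ) d x ≈ x
      Gal-iterate-size≈id = translate-fix⇒τ-period d e (iterate-card≡id translate-injective same-periods e)
        where
        same-periods : ∀ n i j → iterate translate n i ≡ i → iterate translate n j ≡ j
        same-periods n i j = τ-period⇒translate-fix n j ∘ translate-fix⇒τ-period n i

bounded-quotient : ∀ {n m k} → n ∣ m → m < k * n → ∃ λ q → q < k × q * n ≡ m
bounded-quotient {n} {m} {k} (divides q m≡q*n) m<k*n =
  q , *-cancelʳ-< n q k (subst (_< k * n) m≡q*n m<k*n) , ≡.sym m≡q*n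

module _ (N d : ℕ) .{{_ : NonZero N}} where
  instance
    gcd-nonZero : NonZero (gcd N d)
    gcd-nonZero = ≢-nonZero (gcd[m,n]≢0 N d (inj₁ (≢-nonZero⁻¹ N)))

    N/g-nonZero : NonZero (N/g N d)
    N/g-nonZero = >-nonZero (m≥n⇒m/n>0 (∣⇒≤ (gcd[m,n]∣m N d)))

  N≡gcd*N/g : N ≡ gcd N d * N/g N d
  N≡gcd*N/g = ≡.sym (m*[n/m]≡n (gcd[m,n]∣m N d))

  -- N ∣ ds and N ∣ Ns give N ∣ gcd(ds, Ns) = gcd(N, d)·s; cancel gcd(N, d).
  N/g∣ : ∀ {s} → N ∣ d * s → N/g N d ∣ s
  N/g∣ {s} N∣ds = *-cancelˡ-∣ (gcd N d)
    (subst₂ _∣_ N≡gcd*N/g gcd[ds,Ns]≡gcd*s (gcd-greatest N∣ds (m∣m*n s)))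
    where
    open ≡.≡-Reasoning
    gcd[ds,Ns]≡gcd*s : gcd (d * s) (N * s) ≡ gcd N d * s
    gcd[ds,Ns]≡gcd*s = begin
      gcd (d * s) (N * s)   ≡⟨ cong₂ gcd (*-comm d s) (*-comm N s) ⟩
      gcd (s * d) (s * N)   ≡⟨ c*gcd[m,n]≡gcd[cm,cn] s d N ⟨
      s * gcd d N           ≡⟨ cong (s *_) (gcd-comm d N) ⟩
      s * gcd N d           ≡⟨ *-comm s (gcd N d) ⟩
      gcd N d * s           ∎

module Dynamics {a ℓ} (K : ExtensionOfℚ a ℓ) (c : ℚ) where
  open ExtensionOfℚ K using (Carrier; _≈_; setoid; refl; sym; trans; reflexive; +-cong; *-cong)
  open SetoidReasoning setoid
  open Galois K using (Gal-iterate-size≈id)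

  φ-cong : ∀ {x y} → x ≈ y → φ K c x ≈ φ K c y
  φ-cong x≈y = +-cong (*-cong x≈y x≈y) refl

  open SetoidIteration setoid φ-cong using (iterate-cong; iterate-commute; iterate-%; exactPeriod∣)

  Gal-commutes-φ : (τ : Gal K) → ∀ x → proj₁ τ (φ K c x) ≈ φ K c (proj₁ τ x)
  Gal-commutes-φ (τ , τ-aut) x = trans (hom-+ _ _) (+-cong (hom-* x x) (fixes-ℚ c))
    where open IsℚAutomorphism τ-aut

  Gal-commutes-iterate : (τ : Gal K) → ∀ n x → proj₁ τ (iterate (φ K c) n x) ≈ iterate (φ K c) n (proj₁ τ x)
  Gal-commutes-iterate τ = iterate-commute (IsℚAutomorphism.cong (proj₂ τ)) (Gal-commutes-φ τ)

  module _ {N} .{{_ : NonZero N}} {z₀} (exact : IsExactPeriod K c N z₀) where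
    private
      z : ℕ → Carrier
      z = orbit K c z₀

    collision⇒τz₀≈z : (τ : Gal K) → ∀ {i j} → j < N → z i ≈ proj₁ τ (z j) → proj₁ τ z₀ ≈ z ((N ∸ j + i) % N)
    collision⇒τz₀≈z (τ , τ-aut) {i} {j} j<N zᵢ≈τzⱼ = begin
      τ z₀                                ≈⟨ IsℚAutomorphism.cong τ-aut (proj₁ exact) ⟨
      τ (z N)                             ≡⟨ cong (τ ∘ z) (m∸n+n≡m (<⇒≤ j<N)) ⟨
      τ (z (N ∸ j + j))                   ≡⟨ cong τ (iterate-+ (φ K c) (N ∸ j) j z₀) ⟩
      τ (iterate (φ K c) (N ∸ j) (z j))   ≈⟨ Gal-commutes-iterate (τ , τ-aut) (N ∸ j) (z j) ⟩
      iterate (φ K c) (N ∸ j) (τ (z j))   ≈⟨ iterate-cong (N ∸ j) zᵢ≈τzⱼ ⟨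
      iterate (φ K c) (N ∸ j) (z i)       ≡⟨ iterate-+ (φ K c) (N ∸ j) i z₀ ⟨
      z (N ∸ j + i)                       ≈⟨ iterate-% (proj₁ exact) (N ∸ j + i) ⟩
      z ((N ∸ j + i) % N)                 ∎

    Gal-iterate-orbit : (τ : Gal K) → ∀ {s} → proj₁ τ z₀ ≈ z s → ∀ n → iterate (proj₁ τ) n z₀ ≈ z (n * s)
    Gal-iterate-orbit τ         τz₀≈zₛ zero    = refl
    Gal-iterate-orbit (τ , τ-aut) {s} τz₀≈zₛ (suc n) = begin
      τ (iterate τ n z₀)              ≈⟨ IsℚAutomorphism.cong τ-aut (Gal-iterate-orbit (τ , τ-aut) τz₀≈zₛ n) ⟩
      τ (z (n * s))                   ≈⟨ Gal-commutes-iterate (τ , τ-aut) (n * s) z₀ ⟩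
      iterate (φ K c) (n * s) (τ z₀)  ≈⟨ iterate-cong (n * s) τz₀≈zₛ ⟩
      iterate (φ K c) (n * s) (z s)   ≡⟨ iterate-+ (φ K c) (n * s) s z₀ ⟨
      z (n * s + s)                   ≡⟨ cong z (+-comm (n * s) s) ⟩
      z (s + n * s)                   ∎

    τz₀≈zₛ⇒s≡m*N/g : ∀ {d} → GalHasSize K d → (τ : Gal K) → ∀ {s} → proj₁ τ z₀ ≈ z s → s < N →
                            ∃ λ m → m < gcd N d × m * N/g N d ≡ s
    τz₀≈zₛ⇒s≡m*N/g {d} size τ {s} τz₀≈zₛ s<N = bounded-quotient
      (N/g∣ N d (exactPeriod∣ exact (trans (sym (Gal-iterate-orbit τ τz₀≈zₛ d)) (Gal-iterate-size≈id size τ z₀))))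
      (subst (s <_) (N≡gcd*N/g N d) s<N)

    Collision : Gal K → Set ℓ
    Collision τ = ∃ λ i → i < N × ∃ λ j → j < N × z i ≈ proj₁ τ (z j)

    collision? : Decidable _≈_ → ∀ τ → Dec (Collision τ)
    collision? _≟_ τ = anyUpTo? (λ i → anyUpTo? (λ j → z i ≟ proj₁ τ (z j)) N) N

    Collision-resp : ∀ σ τ → _≈Gal_ K σ τ → Collision σ → Collision τ
    Collision-resp σ τ σ≈τ (i , i<N , j , j<N , zᵢ≈σzⱼ) = i , i<N , j , j<N , trans zᵢ≈σzⱼ (σ≈τ (z j))

    collision⇒CaseI : ∀ {d} → GalHasSize K d → (τ : Gal K) → Nontrivial K τ → Collision τ → CaseI K c N d z₀
    collision⇒CaseI size τ nontrivial (i , _ , j , j<N , zᵢ≈τzⱼ) =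
      let τz₀≈zₛ = collision⇒τz₀≈z τ j<N zᵢ≈τzⱼ
          m , m<g , m*N/g≡s = τz₀≈zₛ⇒s≡m*N/g size τ τz₀≈zₛ (m%n<n (N ∸ j + i) N)
      in m , m<g , τ , nontrivial , trans (reflexive (cong z m*N/g≡s)) (sym τz₀≈zₛ)

    no-collision⇒CaseII : ¬ (∃ λ τ → Nontrivial K τ × Collision τ) → CaseII K c N z₀
    no-collision⇒CaseII none τ nontrivial i j i<N j<N zᵢ≈τzⱼ = none (τ , nontrivial , i , i<N , j , j<N , zᵢ≈τzⱼ)

    CaseI-excludes-CaseII : ∀ {d} → ¬ (CaseI K c N d z₀ × CaseII K c N z₀)
    CaseI-excludes-CaseII {d} ((m , m<g , τ , nontrivial , zₘ≈τz₀) , disjoint) =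
      disjoint τ nontrivial (m * N/g N d) 0 m*N/g<N (>-nonZero⁻¹ N) zₘ≈τz₀
      where
      m*N/g<N : m * N/g N d < N
      m*N/g<N = subst (m * N/g N d <_) (≡.sym (N≡gcd*N/g N d)) (*-monoˡ-< (N/g N d) {{N/g-nonZero N d}} m<g)

theorem2p1 : ∀ {a ℓ : Level} (K : ExtensionOfℚ a ℓ) (N d : ℕ) .{{_ : NonZero N}} (c : ℚ) →
    IsGaloisOfDegree K d →
    (z₀ : ExtensionOfℚ.Carrier K) →
    IsExactPeriod K c N z₀ →
    (CaseI K c N d z₀ ⊎ CaseII K c N z₀) × ¬ (CaseI K c N d z₀ × CaseII K c N z₀)
theorem2p1 K N d c (degree , size) z₀ exact = cases , CaseI-excludes-CaseII exact
  where
  open Galois K using (≈-dec; ∃-nontrivial?)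
  open Dynamics K c

  cases : CaseI K c N d z₀ ⊎ CaseII K c N z₀
  cases with ∃-nontrivial? size (Collision exact) (Collision-resp exact) (collision? exact (≈-dec degree))
  ... | yes (τ , nontrivial , collision) = inj₁ (collision⇒CaseI exact size τ nontrivial collision)
  ... | no  none                         = inj₂ (no-collision⇒CaseII exact none)
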